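{- Let $(a_{ij})_{1\le i,j\le n}$ be a real $n\times n$ matrix such that whenever $i<k$ and $j<k$, \[ a_{ik}-a_{ij}<a_{kk}-a_{kj}. \] Then, over all permutations $\sigma$ of $\{1,\dots,n\}$, the sum $S(\sigma)=\sum_{i=1}^n a_{i\sigma(i)}$ attains its maximum value precisely when $\sigma$ is the identity permutation (i.e., the identity is the unique maximizer). -}

module Defs where

open import Level using (Level; _⊔_) renaming (suc to lsuc)
open import Data.Nat using (ℕ; zero; suc)
open import Data.Fin using (Fin; zero; suc)
open import Relation.Binary.Core using (Rel)
open import Relation.Binary.Structures using (IsStrictTotalOrder)
open import Algebra.Core using (Op₁; Op₂)
open import Algebra.Structures using (IsAbelianGroup)

-- The additive ordered group of the real numbers is an instance.
record OrderedAbelianGroup (c ℓ₁ ℓ₂ : Level) : Set (lsuc (c ⊔ ℓ₁ ⊔ ℓ₂)) where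
  infixl 6 _+_ _-_
  infix 8 -_
  infix 4 _≈_ _<_
  field
    Carrier            : Set c
    _≈_                : Rel Carrier ℓ₁
    _<_                : Rel Carrier ℓ₂
    _+_                : Op₂ Carrier
    0#                 : Carrier
    -_                 : Op₁ Carrier
    isAbelianGroup     : IsAbelianGroup _≈_ _+_ 0# -_
    isStrictTotalOrder : IsStrictTotalOrder _≈_ _<_
    +-monoˡ-<          : ∀ z {x y} → x < y → x + z < y + z

  _-_ : Op₂ Carrier
  x - y = x + (- y)

  ∑ : ∀ {n} → (Fin n → Carrier) → Carrier
  ∑ {zero}  f = 0#
  ∑ {suc n} f = f zero + ∑ (λ i → f (suc i))

{-# OPTIONS --safe #-}
-- If σ is not the identity, let k be the largest position it moves.  Then
-- i = σ⁻¹ k and j = σ k both lie below k, and σ′ = σ ∘ (i k) fixes k and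
-- everything above it while trading a_{ik} + a_{kj} for a_{ij} + a_{kk}; the
-- hypothesis for (i, j, k) says exactly that this strictly increases the sum.
-- Repeating, the sum increases strictly until the identity is reached.
module Submission where

open import Defs
open import Level using (Level)
open import Data.Nat as ℕ using (ℕ; z≤n)
import Data.Nat.Properties as ℕ
open import Data.Fin using (Fin; zero; suc; _<_; toℕ; fromℕ<; punchIn; _≟_)
open import Data.Fin.Properties
  using (toℕ-fromℕ<; toℕ-injective; toℕ<n; punchInᵢ≢i; <⇒≢)
  renaming (<-trans to <ᶠ-trans; ≤∧≢⇒< to ≤∧≢⇒<ᶠ)
open import Data.Fin.Permutation
  using (Permutation′; _⟨$⟩ʳ_; _⟨$⟩ˡ_; _∘ₚ_; transpose; inverseʳ)
import Data.Fin.Permutation.Components as PC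
open import Data.Vec.Functional using (updateAt)
open import Data.Vec.Functional.Properties using (updateAt-updates; updateAt-minimal)
open import Data.Product using (∃; _×_; _,_)
open import Data.Sum using (_⊎_; inj₁; inj₂)
open import Function using (_∘_; const)
open import Function.Bundles using (Injection)
open import Function.Properties.Inverse using (↔⇒↣)
open import Relation.Nullary using (¬_; yes; no; contradiction)
open import Relation.Nullary.Decidable using (dec-true; dec-false)
open import Relation.Binary.PropositionalEquality as ≡
  using (_≡_; _≢_; refl; cong; cong₂; subst; subst₂)
open import Relation.Binary.Structures using (IsStrictTotalOrder)
open import Algebra.Bundles using (CommutativeMonoid; AbelianGroup)
import Algebra.Properties.CommutativeMonoid.Sum as CommutativeMonoidSum
import Algebra.Solver.CommutativeMonoid as CommutativeMonoidSolver
import Relation.Binary.Reasoning.Setoid as SetoidReasoning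

transpose-applyˡ : ∀ {n} (i j : Fin n) → PC.transpose i j i ≡ j
transpose-applyˡ i j rewrite dec-true (i ≟ i) refl = refl

transpose-applyʳ : ∀ {n} (i j : Fin n) → PC.transpose i j j ≡ i
transpose-applyʳ i j with j ≟ i
... | yes j≡i = j≡i
... | no _ rewrite dec-true (j ≟ j) refl = refl

transpose-applyᵒ : ∀ {n} {i j k : Fin n} → k ≢ i → k ≢ j → PC.transpose i j k ≡ k
transpose-applyᵒ {i = i} {j} {k} k≢i k≢j
  rewrite dec-false (k ≟ i) k≢i | dec-false (k ≟ j) k≢j = refl

module _ {n : ℕ} (σ : Permutation′ n) (k : Fin n) where

  -- x ↦ σ (τ x) for the transposition τ = (σ⁻¹ k  k): _∘ₚ_ is diagrammatic.
  fixAt : Permutation′ n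
  fixAt = transpose (σ ⟨$⟩ˡ k) k ∘ₚ σ

  fixAt-fixes : fixAt ⟨$⟩ʳ k ≡ k
  fixAt-fixes = ≡.trans (cong (σ ⟨$⟩ʳ_) (transpose-applyʳ (σ ⟨$⟩ˡ k) k)) (inverseʳ σ)

  fixAt-preimage : fixAt ⟨$⟩ʳ (σ ⟨$⟩ˡ k) ≡ σ ⟨$⟩ʳ k
  fixAt-preimage = cong (σ ⟨$⟩ʳ_) (transpose-applyˡ (σ ⟨$⟩ˡ k) k)

  fixAt-other : ∀ {x} → x ≢ σ ⟨$⟩ˡ k → x ≢ k → fixAt ⟨$⟩ʳ x ≡ σ ⟨$⟩ʳ x
  fixAt-other x≢i x≢k = cong (σ ⟨$⟩ʳ_) (transpose-applyᵒ x≢i x≢k)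

FixesFrom : ∀ {n} → ℕ → Permutation′ n → Set
FixesFrom m σ = ∀ x → m ℕ.≤ toℕ x → σ ⟨$⟩ʳ x ≡ x

moved-below : ∀ {n} {σ : Permutation′ n} {k x} → FixesFrom (ℕ.suc (toℕ k)) σ →
              σ ⟨$⟩ʳ x ≢ x → x ≢ k → x < k
moved-below {x = x} fix moved x≢k =
  ≤∧≢⇒<ᶠ (ℕ.≮⇒≥ (λ k<x → moved (fix x k<x))) x≢k

moved-endpoints-below : ∀ {n} {σ : Permutation′ n} {k} → FixesFrom (ℕ.suc (toℕ k)) σ →
                        σ ⟨$⟩ʳ k ≢ k → σ ⟨$⟩ˡ k < k × σ ⟨$⟩ʳ k < k
moved-endpoints-below {σ = σ} {k} fix moved =
  moved-below {σ = σ} {k = k} fix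
    (λ σi≡i → i≢k (≡.trans (≡.sym σi≡i) (inverseʳ σ))) i≢k ,
  moved-below {σ = σ} {k = k} fix (moved ∘ Injection.injective (↔⇒↣ σ)) moved
  where
  i≢k : σ ⟨$⟩ˡ k ≢ k
  i≢k i≡k = moved (≡.trans (cong (σ ⟨$⟩ʳ_) (≡.sym i≡k)) (inverseʳ σ))

fixAt-fixesFrom : ∀ {n} {σ : Permutation′ n} {k} → FixesFrom (ℕ.suc (toℕ k)) σ →
                  σ ⟨$⟩ˡ k < k → FixesFrom (toℕ k) (fixAt σ k)
fixAt-fixesFrom {σ = σ} {k} fix i<k x k≤x with x ≟ k
... | yes refl = fixAt-fixes σ k
... | no x≢k   = ≡.trans (fixAt-other σ k x≢i x≢k) (fix x k<x)
  where
  k<x : k < x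
  k<x = ≤∧≢⇒<ᶠ k≤x (x≢k ∘ ≡.sym)
  x≢i : x ≢ σ ⟨$⟩ˡ k
  x≢i = <⇒≢ (<ᶠ-trans i<k k<x) ∘ ≡.sym

fixed-or-moved : ∀ {n} (σ : Permutation′ n) m → FixesFrom (ℕ.suc m) σ →
                 FixesFrom m σ ⊎ ∃ λ k → toℕ k ≡ m × σ ⟨$⟩ʳ k ≢ k
fixed-or-moved {n} σ m fix with m ℕ.<? n
... | no m≮n = inj₁ (λ x m≤x → contradiction (ℕ.≤-<-trans m≤x (toℕ<n x)) m≮n)
... | yes m<n with σ ⟨$⟩ʳ fromℕ< m<n ≟ fromℕ< m<n
...   | no moved = inj₂ (fromℕ< m<n , toℕ-fromℕ< m<n , moved)
...   | yes fixed = inj₁ fix′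
  where
  fix′ : FixesFrom m σ
  fix′ x m≤x with ℕ.m≤n⇒m<n∨m≡n m≤x
  ... | inj₁ m<x = fix x m<x
  ... | inj₂ m≡x = subst (λ y → σ ⟨$⟩ʳ y ≡ y)
                         (toℕ-injective (≡.trans (toℕ-fromℕ< m<n) m≡x)) fixed

module _ {a ℓ} (M : CommutativeMonoid a ℓ) where
  open CommutativeMonoid M renaming (refl to ≈-refl)
  open CommutativeMonoidSum M using (sum; sum-remove; sum-cong-≋)
  open CommutativeMonoidSolver M using (solve; _⊕_; _⊜_)
  open SetoidReasoning setoid

  sum-exchange : ∀ {n} (f g : Fin n → Carrier) p → (∀ x → x ≢ p → f x ≈ g x) →
                 sum f ∙ g p ≈ sum g ∙ f p
  sum-exchange {ℕ.suc _} f g p agree = begin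
    sum f ∙ g p                        ≈⟨ ∙-congʳ (sum-remove {i = p} f) ⟩
    f p ∙ sum (f ∘ punchIn p) ∙ g p    ≈⟨ ∙-congʳ (∙-congˡ (sum-cong-≋ (λ x → agree _ (punchInᵢ≢i p x)))) ⟩
    f p ∙ sum (g ∘ punchIn p) ∙ g p    ≈⟨ solve 3 (λ x y z → (x ⊕ y) ⊕ z ⊜ (z ⊕ y) ⊕ x) ≈-refl (f p) _ (g p) ⟩
    g p ∙ sum (g ∘ punchIn p) ∙ f p    ≈⟨ ∙-congʳ (sym (sum-remove {i = p} g)) ⟩
    sum g ∙ f p                        ∎

  sum-exchange₂ : ∀ {n} (f g : Fin n → Carrier) {i k} → i ≢ k →
                  (∀ x → x ≢ i → x ≢ k → f x ≈ g x) →
                  sum f ∙ (g i ∙ g k) ≈ sum g ∙ (f i ∙ f k)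
  sum-exchange₂ f g {i} {k} i≢k agree = begin
    sum f ∙ (g i ∙ g k)  ≈⟨ sym (assoc _ _ _) ⟩
    sum f ∙ g i ∙ g k    ≡⟨ cong (λ y → sum f ∙ y ∙ g k) (≡.sym (updateAt-updates i f)) ⟩
    sum f ∙ h i ∙ g k    ≈⟨ ∙-congʳ (sum-exchange f h i f≈h) ⟩
    sum h ∙ f i ∙ g k    ≈⟨ solve 3 (λ x y z → (x ⊕ y) ⊕ z ⊜ (x ⊕ z) ⊕ y) ≈-refl (sum h) (f i) (g k) ⟩
    sum h ∙ g k ∙ f i    ≈⟨ ∙-congʳ (sum-exchange h g k h≈g) ⟩
    sum g ∙ h k ∙ f i    ≡⟨ cong (λ y → sum g ∙ y ∙ f i) (updateAt-minimal k i f (i≢k ∘ ≡.sym)) ⟩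
    sum g ∙ f k ∙ f i    ≈⟨ solve 3 (λ x y z → (x ⊕ y) ⊕ z ⊜ x ⊕ (z ⊕ y)) ≈-refl (sum g) (f k) (f i) ⟩
    sum g ∙ (f i ∙ f k)  ∎
    where
    h : Fin _ → Carrier
    h = updateAt f i (const (g i))
    f≈h : ∀ x → x ≢ i → f x ≈ h x
    f≈h x x≢i = reflexive (≡.sym (updateAt-minimal x i f x≢i))
    h≈g : ∀ x → x ≢ k → h x ≈ g x
    h≈g x x≢k with x ≟ i
    ... | yes refl = reflexive (updateAt-updates i f)
    ... | no x≢i   = trans (sym (f≈h x x≢i)) (agree x x≢i x≢k)

module OrderedAbelianGroupProperties {c ℓ₁ ℓ₂} (G : OrderedAbelianGroup c ℓ₁ ℓ₂) where
  open OrderedAbelianGroup G renaming (_<_ to _<ᴳ_)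
  open IsStrictTotalOrder isStrictTotalOrder using (<-respˡ-≈; <-respʳ-≈)

  abelianGroup : AbelianGroup c ℓ₁
  abelianGroup = record { isAbelianGroup = isAbelianGroup }

  open AbelianGroup abelianGroup
    using (setoid; sym; trans; reflexive; assoc; comm; ∙-congˡ; ∙-congʳ;
           identityˡ; identityʳ; commutativeMonoid)
    renaming (inverseˡ to -‿inverseˡ; inverseʳ to -‿inverseʳ)
  open CommutativeMonoidSum commutativeMonoid using (sum; sum-cong-≗)
  open SetoidReasoning setoid

  <-resp₂ : ∀ {x x′ y y′} → x ≈ x′ → y ≈ y′ → x <ᴳ y → x′ <ᴳ y′
  <-resp₂ x≈x′ y≈y′ x<y = <-respʳ-≈ y≈y′ (<-respˡ-≈ x≈x′ x<y)

  +-monoʳ-< : ∀ z {x y} → x <ᴳ y → z + x <ᴳ z + y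
  +-monoʳ-< z x<y = <-resp₂ (comm _ z) (comm _ z) (+-monoˡ-< z x<y)

  +-cancelʳ-< : ∀ z {x y} → x + z <ᴳ y + z → x <ᴳ y
  +-cancelʳ-< z x+z<y+z = <-resp₂ (+-z _) (+-z _) (+-monoˡ-< (- z) x+z<y+z)
    where
    +-z : ∀ u → u + z - z ≈ u
    +-z u = trans (assoc u z (- z)) (trans (∙-congˡ (-‿inverseʳ z)) (identityʳ u))

  -+-cancel : ∀ x y w → x - y + (y + w) ≈ x + w
  -+-cancel x y w = begin
    x - y + (y + w)      ≈⟨ assoc x (- y) (y + w) ⟩
    x + (- y + (y + w))  ≈⟨ ∙-congˡ (sym (assoc (- y) y w)) ⟩
    x + (- y + y + w)    ≈⟨ ∙-congˡ (∙-congʳ (-‿inverseˡ y)) ⟩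
    x + (0# + w)         ≈⟨ ∙-congˡ (identityˡ w) ⟩
    x + w                ∎

  x-y<z-w⇒x+w<z+y : ∀ x y z w → x - y <ᴳ z - w → x + w <ᴳ z + y
  x-y<z-w⇒x+w<z+y x y z w lt =
    <-resp₂ (-+-cancel x y w) (trans (∙-congˡ (comm y w)) (-+-cancel z w y))
            (+-monoˡ-< (y + w) lt)

  ∑≡sum : ∀ {n} (f : Fin n → Carrier) → ∑ f ≡ sum f
  ∑≡sum {ℕ.zero}  f = refl
  ∑≡sum {ℕ.suc n} f = cong (f zero +_) (∑≡sum (f ∘ suc))

  ∑-cong : ∀ {n} {f g : Fin n → Carrier} → (∀ x → f x ≡ g x) → ∑ f ≡ ∑ g
  ∑-cong {f = f} {g} f≗g =
    ≡.trans (∑≡sum f) (≡.trans (sum-cong-≗ f≗g) (≡.sym (∑≡sum g)))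

  ∑-<-exchange₂ : ∀ {n} (f g : Fin n → Carrier) {i k} → i ≢ k →
                  (∀ x → x ≢ i → x ≢ k → f x ≈ g x) →
                  f i + f k <ᴳ g i + g k → ∑ f <ᴳ ∑ g
  ∑-<-exchange₂ f g {i} {k} i≢k agree gain
    rewrite ∑≡sum f | ∑≡sum g =
    +-cancelʳ-< (f i + f k)
      (<-respʳ-≈ (sum-exchange₂ commutativeMonoid f g i≢k agree) (+-monoʳ-< (sum f) gain))

module _ {c ℓ₁ ℓ₂} (G : OrderedAbelianGroup c ℓ₁ ℓ₂) where
  open OrderedAbelianGroup G renaming (_<_ to _<ᴳ_)
  open IsStrictTotalOrder isStrictTotalOrder using (<-respʳ-≈) renaming (trans to <ᴳ-trans)
  open OrderedAbelianGroupProperties G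
  open AbelianGroup abelianGroup using (reflexive; comm)

  module _ {n} (a : Fin n → Fin n → Carrier)
           (diagonal-gain : ∀ i j k → i < k → j < k → a i k - a i j <ᴳ a k k - a k j) where

    S : Permutation′ n → Carrier
    S σ = ∑ (λ i → a i (σ ⟨$⟩ʳ i))

    fixAt-increases-S : ∀ σ k → σ ⟨$⟩ˡ k < k → σ ⟨$⟩ʳ k < k → S σ <ᴳ S (fixAt σ k)
    fixAt-increases-S σ k i<k j<k =
      ∑-<-exchange₂ _ _ (<⇒≢ i<k) agree (subst₂ _<ᴳ_ before after gain)
      where
      i j : Fin n
      i = σ ⟨$⟩ˡ k
      j = σ ⟨$⟩ʳ k
      gain : a i k + a k j <ᴳ a i j + a k k
      gain = <-respʳ-≈ (comm _ _) (x-y<z-w⇒x+w<z+y _ _ _ _ (diagonal-gain i j k i<k j<k))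
      before : a i k + a k j ≡ a i (σ ⟨$⟩ʳ i) + a k j
      before = cong (λ y → a i y + a k j) (≡.sym (inverseʳ σ))
      after : a i j + a k k ≡ a i (fixAt σ k ⟨$⟩ʳ i) + a k (fixAt σ k ⟨$⟩ʳ k)
      after = cong₂ (λ y z → a i y + a k z)
                    (≡.sym (fixAt-preimage σ k)) (≡.sym (fixAt-fixes σ k))
      agree : ∀ x → x ≢ i → x ≢ k → a x (σ ⟨$⟩ʳ x) ≈ a x (fixAt σ k ⟨$⟩ʳ x)
      agree x x≢i x≢k = reflexive (cong (a x) (≡.sym (fixAt-other σ k x≢i x≢k)))

    fixAt-step : ∀ σ k → FixesFrom (ℕ.suc (toℕ k)) σ → σ ⟨$⟩ʳ k ≢ k →
                 FixesFrom (toℕ k) (fixAt σ k) × S σ <ᴳ S (fixAt σ k)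
    fixAt-step σ k fix moved =
      let i<k , j<k = moved-endpoints-below {σ = σ} {k} fix moved
      in  fixAt-fixesFrom {σ = σ} fix i<k , fixAt-increases-S σ k i<k j<k

    IdentityOrBelow : Permutation′ n → Set ℓ₂
    IdentityOrBelow σ = (∀ x → σ ⟨$⟩ʳ x ≡ x) ⊎ S σ <ᴳ ∑ (λ i → a i i)

    <-IdentityOrBelow : ∀ σ σ′ → S σ <ᴳ S σ′ → IdentityOrBelow σ′ →
                        S σ <ᴳ ∑ (λ i → a i i)
    <-IdentityOrBelow _ _ S<S′ (inj₁ σ′-id) =
      <-respʳ-≈ (reflexive (∑-cong (cong₂ a refl ∘ σ′-id))) S<S′
    <-IdentityOrBelow _ _ S<S′ (inj₂ S′<)   = <ᴳ-trans S<S′ S′<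

    identityOrBelow : ∀ m σ → FixesFrom m σ → IdentityOrBelow σ
    identityOrBelow ℕ.zero    σ fix = inj₁ (λ x → fix x z≤n)
    identityOrBelow (ℕ.suc m) σ fix with fixed-or-moved σ m fix
    ... | inj₁ fix′ = identityOrBelow m σ fix′
    ... | inj₂ (k , k≡m , moved) =
      let σ′ = fixAt σ k
          fix′ , S<S′ =
            fixAt-step σ k (subst (λ l → FixesFrom (ℕ.suc l) σ) (≡.sym k≡m) fix) moved
      in  inj₂ (<-IdentityOrBelow σ σ′ S<S′
                  (identityOrBelow m σ′ (subst (λ l → FixesFrom l σ′) k≡m fix′)))

lemma4p6 : ∀ {c ℓ₁ ℓ₂ : Level} (G : OrderedAbelianGroup c ℓ₁ ℓ₂) (n : ℕ)
           (a : Fin n → Fin n → OrderedAbelianGroup.Carrier G) →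
           (∀ i j k → i < k → j < k →
             OrderedAbelianGroup._<_ G
               (OrderedAbelianGroup._-_ G (a i k) (a i j))
               (OrderedAbelianGroup._-_ G (a k k) (a k j))) →
           ∀ (σ : Permutation′ n) → ¬ (∀ i → σ ⟨$⟩ʳ i ≡ i) →
           OrderedAbelianGroup._<_ G
             (OrderedAbelianGroup.∑ G (λ i → a i (σ ⟨$⟩ʳ i)))
             (OrderedAbelianGroup.∑ G (λ i → a i i))
lemma4p6 G n a diagonal-gain σ σ≢id
  with identityOrBelow G a diagonal-gain n σ
         (λ x n≤x → contradiction (toℕ<n x) (ℕ.≤⇒≯ n≤x))
... | inj₁ σ-id = contradiction σ-id σ≢id
... | inj₂ S<   = S<
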